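{- Let $F$ be an $r$-graph, $i\in[r-1]$, and $T\in\binom{V(F)}{i}$ such that $F(T)$ is non-empty. Let $G$ be a complex and $S\in\binom{V(G)}{i}$. Let $L\subseteq G(S)^{(r-i)}$, and suppose that $\mathcal{F}'$ is a $\kappa$-well separated $F(T)$-decomposition of the complex $G(S)[L]$. Then $\mathcal{F}:=S\triangleleft\mathcal{F}'$ is a $\kappa$-well separated $F$-packing in $G$, and $\{e\in\mathcal{F}^{(r)}: S\subseteq e\}=S\uplus L$.
   Context: For a $k$-graph $H$ and $S\subseteq V(H)$, $H(S)$ is the $(k-|S|)$-graph on $V(H)\setminus S$ of all $e$ with $S\cup e\in H$. A complex $G$ is a hypergraph closed under taking subsets of edges; $G^{(j)}$ is its $j$-graph of edges of size $j$; $G(S)$ is the complex on $V(G)\setminus S$ of all $e$ with $S\cup e\in G$. For a complex $G'$ and a $k$-graph $L$, $G'[L]$ is the complex on $V(G')$ consisting of all $e\in G'$ with $\binom{e}{k}\subseteq L$. For a $k$-graph $F_0$ on $f_0$ vertices, an $F_0$-packing in a complex $G'$ is a set of edge-disjoint copies $F'$ of $F_0$ in $G'^{(k)}$ with $V(F')\in G'^{(f_0)}$; it is an $F_0$-decomposition of $G'$ if it covers every edge of $G'^{(k)}$. A packing $\mathcal{P}$ of copies of a $k$-graph is $\kappa$-well separated if (WS1) any two distinct members share at most $k$ vertices and (WS2) every $k$-set lies in the vertex set of at most $\kappa$ members; it is well separated if (WS1) holds. For a well separated $F(T)$-packing $\mathcal{F}'$ in $G(S)$, $S\triangleleft\mathcal{F}'$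 is defined as $\{F'_\triangleleft:F'\in\mathcal{F}'\}$, where for each $F'$, $F'_\triangleleft$ is an arbitrary copy of $F$ on vertex set $S\cup V(F')$ with $F'_\triangleleft(S)=F'$. $\mathcal{F}^{(r)}$ is the union of the edge sets of members of $\mathcal{F}$, and $S\uplus L:=\{S\cup e:e\in L\}$. -}

module Defs where

open import Data.Nat using (ℕ; _≤_; _∸_)
open import Data.Fin using (Fin)
open import Data.Fin.Subset using (Subset; _∈_; _⊆_; _∪_; _∩_; _─_; ∣_∣)
open import Data.Product using (Σ; ∃; _×_; proj₁)
open import Relation.Binary.PropositionalEquality using (_≡_; _≢_)
open import Relation.Nullary using (¬_)

-- A hypergraph on the ambient vertex universe Fin n: a vertex set V and an
-- edge set E (a predicate on subsets of Fin n), every edge lying inside V.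
record Hypergraph (n : ℕ) : Set₁ where
  field
    V   : Subset n
    E   : Subset n → Set
    E⊆V : ∀ e → E e → e ⊆ V
open Hypergraph public

Uniform : ∀ {n} → ℕ → Hypergraph n → Set
Uniform k H = ∀ e → E H e → ∣ e ∣ ≡ k

IsComplex : ∀ {n} → Hypergraph n → Set
IsComplex G = ∀ e e' → E G e → e' ⊆ e → E G e'

link : ∀ {n} → Hypergraph n → Subset n → Hypergraph n
link H S = record
  { V   = V H ─ S
  ; E   = λ e → (e ⊆ V H ─ S) × E H (S ∪ e)
  ; E⊆V = λ e p → proj₁ p }

level : ∀ {n} → Hypergraph n → ℕ → Subset n → Set
level G j e = E G e × ∣ e ∣ ≡ j

restrict : ∀ {n} → Hypergraph n → ℕ → (Subset n → Set) → Hypergraph n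
restrict G k L = record
  { V   = V G
  ; E   = λ e → E G e × (∀ x → x ⊆ e → ∣ x ∣ ≡ k → L x)
  ; E⊆V = λ e p → E⊆V G e (proj₁ p) }

MapsOnto : ∀ {m n} → (Fin m → Fin n) → Subset m → Subset n → Set
MapsOnto φ e e' = (∀ x → x ∈ e → φ x ∈ e') × (∀ y → y ∈ e' → ∃ λ x → x ∈ e × φ x ≡ y)

IsCopy : ∀ {m n} → Hypergraph m → Hypergraph n → Set
IsCopy {m} {n} H H' = Σ (Fin m → Fin n) λ φ →
    (∀ x → x ∈ V H → φ x ∈ V H')
  × (∀ x y → x ∈ V H → y ∈ V H → φ x ≡ φ y → x ≡ y)
  × (∀ y → y ∈ V H' → ∃ λ x → x ∈ V H × φ x ≡ y)
  × (∀ e → E H e → ∃ λ e' → MapsOnto φ e e' × E H' e')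
  × (∀ e' → E H' e' → ∃ λ e → E H e × MapsOnto φ e e')

-- A finite family of hypergraphs (members indexed by Fin m; distinct
-- indices are distinct members).
Family : ℕ → ℕ → Set₁
Family m n = Fin m → Hypergraph n

EdgeDisjoint : ∀ {m n} → Family m n → Set
EdgeDisjoint 𝓕 = ∀ i j → i ≢ j → ∀ e → ¬ (E (𝓕 i) e × E (𝓕 j) e)

IsPacking : ∀ {f m n} → ℕ → Hypergraph f → Hypergraph n → Family m n → Set
IsPacking {m = m} k F0 G' 𝓕 =
    (∀ i → IsCopy F0 (𝓕 i))
  × (∀ i e → E (𝓕 i) e → level G' k e)
  × (∀ i → level G' ∣ V F0 ∣ (V (𝓕 i)))
  × EdgeDisjoint 𝓕

IsDecomposition : ∀ {f m n} → ℕ → Hypergraph f → Hypergraph n → Family m n → Set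
IsDecomposition k F0 G' 𝓕 =
  IsPacking k F0 G' 𝓕 × (∀ e → level G' k e → ∃ λ i → E (𝓕 i) e)

WS1 : ∀ {m n} → ℕ → Family m n → Set
WS1 k 𝓕 = ∀ i j → i ≢ j → ∣ V (𝓕 i) ∩ V (𝓕 j) ∣ ≤ k

-- (WS2): every k-set lies in the vertex set of at most κ members
-- (any set J of members whose vertex sets all contain it has |J| ≤ κ).
WS2 : ∀ {m n} → ℕ → ℕ → Family m n → Set
WS2 {m} {n} κ k 𝓕 = ∀ (x : Subset n) → ∣ x ∣ ≡ k →
  ∀ (J : Subset m) → (∀ i → i ∈ J → x ⊆ V (𝓕 i)) → ∣ J ∣ ≤ κ

WellSeparated : ∀ {m n} → ℕ → ℕ → Family m n → Set
WellSeparated κ k 𝓕 = WS1 k 𝓕 × WS2 κ k 𝓕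

SameHypergraph : ∀ {n} → Hypergraph n → Hypergraph n → Set
SameHypergraph H H' = V H ≡ V H' × (∀ e → (E H e → E H' e) × (E H' e → E H e))

-- 𝓕 = S ◁ 𝓕' (for an arbitrary choice of the copies F'_◁): member i is a
-- copy of F on vertex set S ∪ V(F'_i) with (F_i)(S) = F'_i.
IsTriangle : ∀ {f m n} → Hypergraph f → Subset n → Family m n → Family m n → Set
IsTriangle F S 𝓕' 𝓕 = ∀ i →
  IsCopy F (𝓕 i) × V (𝓕 i) ≡ S ∪ V (𝓕' i) × SameHypergraph (link (𝓕 i) S) (𝓕' i)

-- Every member of S ◁ 𝓕' has vertex set S ∪ V(F'), so two members meet in S
-- together with the intersection of the corresponding members of 𝓕'; this lifts
-- (WS1) and (WS2) from order r − i to order r. An r-edge shared by two members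
-- therefore fills their whole intersection and contains S, so removing S yields
-- an edge shared by the corresponding members of 𝓕', contradicting their
-- disjointness. The edges of S ◁ 𝓕' containing S are exactly the S ∪ e' with
-- e' ∈ 𝓕'^{(r−i)}, and since 𝓕' decomposes G(S)[L] these e' are exactly L.
module Submission where

open import Defs
open import Data.Nat using (ℕ; _≤_; _∸_)
open import Data.Fin.Subset using (Subset; _⊆_; _∪_; ∣_∣)
open import Data.Product using (Σ; ∃; _×_)
open import Relation.Binary.PropositionalEquality using (_≡_)

open import Data.Empty using (⊥-elim)
open import Data.Fin using (Fin; zero; suc)
import Data.Fin.Properties as Fin
open import Data.Fin.Subset using (Side; inside; outside; _∈_; _∉_; _∩_; _─_; _-_)
  renaming (⊥ to ∅)
open import Data.Fin.Subset.Properties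
open import Data.Nat using (zero; suc; z≤n; s≤s; s≤s⁻¹; _+_)
open import Data.Nat.Properties
  using (≤-trans; ≤-reflexive; ≤-antisym; n≤1+n; +-suc; +-monoʳ-≤;
         +-cancelˡ-≤; <-irrefl; m∸n≤m; m+[n∸m]≡n)
open import Data.Product using (_,_; proj₁; proj₂)
open import Data.Sum using (inj₁; inj₂)
open import Data.Vec using (_∷_; []; here; there)
open import Function using (id; _∘_)
open import Relation.Binary.PropositionalEquality
  using (_≢_; refl; sym; trans; cong; subst)
open import Relation.Nullary using (Dec; yes; no; contradiction)

private
  variable
    n : ℕ

∣p∪q∣≤∣p∣+∣q∣ : (p q : Subset n) → ∣ p ∪ q ∣ ≤ ∣ p ∣ + ∣ q ∣
∣p∪q∣≤∣p∣+∣q∣ []            []            = z≤n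
∣p∪q∣≤∣p∣+∣q∣ (outside ∷ p) (outside ∷ q) = ∣p∪q∣≤∣p∣+∣q∣ p q
∣p∪q∣≤∣p∣+∣q∣ (inside  ∷ p) (outside ∷ q) = s≤s (∣p∪q∣≤∣p∣+∣q∣ p q)
∣p∪q∣≤∣p∣+∣q∣ (outside ∷ p) (inside  ∷ q) =
  ≤-trans (s≤s (∣p∪q∣≤∣p∣+∣q∣ p q)) (≤-reflexive (sym (+-suc ∣ p ∣ ∣ q ∣)))
∣p∪q∣≤∣p∣+∣q∣ (inside  ∷ p) (inside  ∷ q) =
  s≤s (≤-trans (≤-trans (∣p∪q∣≤∣p∣+∣q∣ p q) (n≤1+n _)) (≤-reflexive (sym (+-suc ∣ p ∣ ∣ q ∣))))

p⊆q∧∣q∣≤∣p∣⇒p≡q : {p q : Subset n} → p ⊆ q → ∣ q ∣ ≤ ∣ p ∣ → p ≡ q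
p⊆q∧∣q∣≤∣p∣⇒p≡q {p = []}          {[]}          _   _ = refl
p⊆q∧∣q∣≤∣p∣⇒p≡q {p = outside ∷ p} {outside ∷ q} p⊆q ∣q∣≤∣p∣ =
  cong (outside ∷_) (p⊆q∧∣q∣≤∣p∣⇒p≡q (drop-∷-⊆ p⊆q) ∣q∣≤∣p∣)
p⊆q∧∣q∣≤∣p∣⇒p≡q {p = inside  ∷ p} {inside  ∷ q} p⊆q ∣q∣≤∣p∣ =
  cong (inside ∷_) (p⊆q∧∣q∣≤∣p∣⇒p≡q (drop-∷-⊆ p⊆q) (s≤s⁻¹ ∣q∣≤∣p∣))
p⊆q∧∣q∣≤∣p∣⇒p≡q {p = inside  ∷ p} {outside ∷ q} p⊆q _ = contradiction (p⊆q here) λ ()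
p⊆q∧∣q∣≤∣p∣⇒p≡q {p = outside ∷ p} {inside  ∷ q} p⊆q ∣q∣≤∣p∣ =
  ⊥-elim (<-irrefl refl (≤-trans ∣q∣≤∣p∣ (p⊆q⇒∣p∣≤∣q∣ (drop-∷-⊆ p⊆q))))

∃-⊆-ofSize : ∀ k (p : Subset n) → k ≤ ∣ p ∣ → ∃ λ q → q ⊆ p × ∣ q ∣ ≡ k
∃-⊆-ofSize {n} zero p _ = ∅ , ⊥-elim ∘ ∉⊥ , ∣⊥∣≡0 n
∃-⊆-ofSize (suc k) (inside ∷ p) (s≤s k≤∣p∣) with ∃-⊆-ofSize k p k≤∣p∣
... | q , q⊆p , ∣q∣≡k = inside ∷ q , ∷⊆∷ q⊆p , cong suc ∣q∣≡k
  where
  ∷⊆∷ : q ⊆ p → inside ∷ q ⊆ inside ∷ p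
  ∷⊆∷ _   here      = here
  ∷⊆∷ q⊆p (there x) = there (q⊆p x)
∃-⊆-ofSize (suc k) (outside ∷ p) k<∣p∣ with ∃-⊆-ofSize (suc k) p k<∣p∣
... | q , q⊆p , ∣q∣≡k = outside ∷ q , ∷⊆∷ q⊆p , ∣q∣≡k
  where
  ∷⊆∷ : q ⊆ p → outside ∷ q ⊆ outside ∷ p
  ∷⊆∷ q⊆p (there x) = there (q⊆p x)

x∈p─q⇒x∉q : {x : Fin n} (p q : Subset n) → x ∈ p ─ q → x ∉ q
x∈p─q⇒x∉q (_ ∷ p) (_      ∷ q) (there x∈p─q) (there x∈q) = x∈p─q⇒x∉q p q x∈p─q x∈q
x∈p─q⇒x∉q (_ ∷ p) (inside ∷ q) ()            here

x∈p∪q∧x∉p⇒x∈q : {x : Fin n} (p q : Subset n) → x ∈ p ∪ q → x ∉ p → x ∈ q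
x∈p∪q∧x∉p⇒x∈q p q x∈p∪q x∉p with x∈p∪q⁻ p q x∈p∪q
... | inj₁ x∈p = contradiction x∈p x∉p
... | inj₂ x∈q = x∈q

q⊆p∪[q─p] : (p q : Subset n) → q ⊆ p ∪ (q ─ p)
q⊆p∪[q─p] p q {x} x∈q with x ∈? p
... | yes x∈p = x∈p∪q⁺ (inj₁ x∈p)
... | no  x∉p = x∈p∪q⁺ (inj₂ (x∈p∧x∉q⇒x∈p─q x∈q x∉p))

p⊆q⇒p∪[q─p]≡q : {p q : Subset n} → p ⊆ q → p ∪ (q ─ p) ≡ q
p⊆q⇒p∪[q─p]≡q {p = p} {q} p⊆q = ⊆-antisym p∪[q─p]⊆q (q⊆p∪[q─p] p q)
  where
  p∪[q─p]⊆q : p ∪ (q ─ p) ⊆ q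
  p∪[q─p]⊆q x∈ with x∈p∪q⁻ p (q ─ p) x∈
  ... | inj₁ x∈p   = p⊆q x∈p
  ... | inj₂ x∈q─p = p─q⊆p q p x∈q─p

∣q∣≤∣p∣+∣q─p∣ : (p q : Subset n) → ∣ q ∣ ≤ ∣ p ∣ + ∣ q ─ p ∣
∣q∣≤∣p∣+∣q─p∣ p q = ≤-trans (p⊆q⇒∣p∣≤∣q∣ (q⊆p∪[q─p] p q)) (∣p∪q∣≤∣p∣+∣q∣ p (q ─ p))

module _ {m : ℕ} (φ : Fin m → Fin n) where

  InjectiveOn : Subset m → Set
  InjectiveOn p = ∀ x y → x ∈ p → y ∈ p → φ x ≡ φ y → x ≡ y

  MapsInto : Subset m → Subset n → Set
  MapsInto p q = ∀ x → x ∈ p → φ x ∈ q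

  Covers : Subset m → Subset n → Set
  Covers p q = ∀ y → y ∈ q → ∃ λ x → x ∈ p × φ x ≡ y

injectiveOn-tail : ∀ {m} (φ : Fin (suc m) → Fin n) {s : Side} {p : Subset m} →
  InjectiveOn φ (s ∷ p) → InjectiveOn (φ ∘ suc) p
injectiveOn-tail φ inj x y x∈p y∈p = Fin.suc-injective ∘ inj (suc x) (suc y) (there x∈p) (there y∈p)

injectiveOn⇒∣p∣≤∣q∣ : ∀ {m} (φ : Fin m → Fin n) (p : Subset m) (q : Subset n) →
  MapsInto φ p q → InjectiveOn φ p → ∣ p ∣ ≤ ∣ q ∣
injectiveOn⇒∣p∣≤∣q∣ φ [] q _ _ = z≤n
injectiveOn⇒∣p∣≤∣q∣ φ (outside ∷ p) q into inj =
  injectiveOn⇒∣p∣≤∣q∣ (φ ∘ suc) p q (λ x → into (suc x) ∘ there) (injectiveOn-tail φ inj)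
-- The image of 0 is removed from q, so the rest of p still maps injectively into it.
injectiveOn⇒∣p∣≤∣q∣ φ (inside ∷ p) q into inj =
  ≤-trans (s≤s (injectiveOn⇒∣p∣≤∣q∣ (φ ∘ suc) p (q - φ zero) into′ (injectiveOn-tail φ inj)))
          (x∈p⇒∣p-x∣<∣p∣ (into zero here))
  where
  into′ : MapsInto (φ ∘ suc) p (q - φ zero)
  into′ x x∈p = x∈p∧x≢y⇒x∈p-y (into (suc x) (there x∈p))
    (Fin.0≢1+n ∘ inj zero (suc x) here (there x∈p) ∘ sym)

-- A choice of preimages is an injection from q into p.
covers⇒∣q∣≤∣p∣ : ∀ {m} (φ : Fin m → Fin n) (p : Subset m) (q : Subset n) →
  Covers φ p q → ∣ q ∣ ≤ ∣ p ∣
covers⇒∣q∣≤∣p∣ {n} {zero} φ p q cover =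
  ≤-trans (p⊆q⇒∣p∣≤∣q∣ q⊆∅) (≤-trans (≤-reflexive (∣⊥∣≡0 n)) z≤n)
  where
  q⊆∅ : q ⊆ ∅
  q⊆∅ {y} y∈q with cover y y∈q
  ... | () , _
covers⇒∣q∣≤∣p∣ {m = suc _} φ p q cover =
  injectiveOn⇒∣p∣≤∣q∣ ψ q p (λ y y∈q → proj₁ (ψ-preimage y y∈q (y ∈? q))) ψ-injective
  where
  choose : ∀ y → Dec (y ∈ q) → Fin _
  choose y (yes y∈q) = proj₁ (cover y y∈q)
  choose y (no  _)   = zero
  ψ : Fin _ → Fin _
  ψ y = choose y (y ∈? q)
  ψ-preimage : ∀ y → y ∈ q → (d : Dec (y ∈ q)) → choose y d ∈ p × φ (choose y d) ≡ y
  ψ-preimage y _   (yes y∈q) = proj₂ (cover y y∈q)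
  ψ-preimage y y∈q (no  y∉q) = contradiction y∈q y∉q
  ψ-injective : InjectiveOn ψ q
  ψ-injective x y x∈q y∈q ψx≡ψy =
    trans (sym (proj₂ (ψ-preimage x x∈q (x ∈? q))))
      (trans (cong φ ψx≡ψy) (proj₂ (ψ-preimage y y∈q (y ∈? q))))

mapsOnto⇒∣q∣≡∣p∣ : ∀ {m} (φ : Fin m → Fin n) {p : Subset m} {q : Subset n} →
  InjectiveOn φ p → MapsOnto φ p q → ∣ q ∣ ≡ ∣ p ∣
mapsOnto⇒∣q∣≡∣p∣ φ {p} {q} inj (into , cover) =
  ≤-antisym (covers⇒∣q∣≤∣p∣ φ p q cover) (injectiveOn⇒∣p∣≤∣q∣ φ p q into inj)

module _ {f} {F : Hypergraph f} {H : Hypergraph n} where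

  copy-∣V∣ : IsCopy F H → ∣ V H ∣ ≡ ∣ V F ∣
  copy-∣V∣ (φ , into , inj , cover , _) = mapsOnto⇒∣q∣≡∣p∣ φ inj (into , cover)

  copy-uniform : ∀ {r} → Uniform r F → IsCopy F H → Uniform r H
  copy-uniform F-unif (φ , _ , inj , _ , _ , edge⁻) e e∈H with edge⁻ e e∈H
  ... | e₀ , e₀∈F , e₀↦e =
    trans (mapsOnto⇒∣q∣≡∣p∣ φ (λ x y x∈ y∈ → inj x y (E⊆V F e₀ e₀∈F x∈) (E⊆V F e₀ e₀∈F y∈)) e₀↦e)
          (F-unif e₀ e₀∈F)

-- The (WS1) bound ∣V a ∩ V b∣ ≤ r leaves no room beside an r-edge of both.
shared-edge≡∩ : ∀ {m r} (𝓕 : Family m n) → WS1 r 𝓕 → (∀ j → Uniform r (𝓕 j)) →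
  ∀ {a b e} → a ≢ b → E (𝓕 a) e → E (𝓕 b) e → e ≡ V (𝓕 a) ∩ V (𝓕 b)
shared-edge≡∩ 𝓕 ws1 unif {a} {b} {e} a≢b e∈a e∈b =
  p⊆q∧∣q∣≤∣p∣⇒p≡q (λ x∈e → x∈p∩q⁺ (E⊆V (𝓕 a) e e∈a x∈e , E⊆V (𝓕 b) e e∈b x∈e))
    (≤-trans (ws1 a b a≢b) (≤-reflexive (sym (unif a e e∈a))))

restrict-level⁺ : ∀ {G : Hypergraph n} {k} {L : Subset n → Set} {e} →
  L e → level G k e → level (restrict G k L) k e
restrict-level⁺ {L = L} Le (e∈G , ∣e∣≡k) =
  (e∈G , λ x x⊆e ∣x∣≡k → subst L (sym (p⊆q∧∣q∣≤∣p∣⇒p≡q x⊆e (≤-reflexive (trans ∣e∣≡k (sym ∣x∣≡k))))) Le)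
  , ∣e∣≡k

restrict-level⁻ : ∀ {G : Hypergraph n} {k} {L : Subset n → Set} {e} →
  level (restrict G k L) k e → L e
restrict-level⁻ {e = e} ((_ , k-subsets∈L) , ∣e∣≡k) = k-subsets∈L e id ∣e∣≡k

module Extension {m} (S : Subset n) (𝓕′ 𝓕 : Family m n)
  (V-◁ : ∀ j → V (𝓕 j) ≡ S ∪ V (𝓕′ j))
  (link-◁ : ∀ j → SameHypergraph (link (𝓕 j) S) (𝓕′ j)) where

  edge-◁⁺ : ∀ {j e} → E (𝓕′ j) e → E (𝓕 j) (S ∪ e)
  edge-◁⁺ {j} {e} e∈𝓕′ = proj₂ (proj₂ (proj₂ (link-◁ j) e) e∈𝓕′)

  edge-◁⁻ : ∀ {j e} → E (𝓕 j) e → S ⊆ e → E (𝓕′ j) (e ─ S)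
  edge-◁⁻ {j} {e} e∈𝓕 S⊆e = proj₁ (proj₂ (link-◁ j) (e ─ S))
    ( (λ x∈e─S → x∈p∧x∉q⇒x∈p─q (E⊆V (𝓕 j) e e∈𝓕 (p─q⊆p e S x∈e─S)) (x∈p─q⇒x∉q e S x∈e─S))
    , subst (E (𝓕 j)) (sym (p⊆q⇒p∪[q─p]≡q S⊆e)) e∈𝓕 )

  ∈V-◁ : ∀ {j x} → x ∈ V (𝓕 j) → x ∈ S ∪ V (𝓕′ j)
  ∈V-◁ {j} {x} = subst (x ∈_) (V-◁ j)

  S⊆V-◁ : ∀ j → S ⊆ V (𝓕 j)
  S⊆V-◁ j {x} = subst (x ∈_) (sym (V-◁ j)) ∘ p⊆p∪q _

  ws1-◁ : ∀ {k} → WS1 k 𝓕′ → WS1 (∣ S ∣ + k) 𝓕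
  ws1-◁ ws1′ a b a≢b =
    ≤-trans (p⊆q⇒∣p∣≤∣q∣ ∩⊆S∪∩′)
      (≤-trans (∣p∪q∣≤∣p∣+∣q∣ S _) (+-monoʳ-≤ ∣ S ∣ (ws1′ a b a≢b)))
    where
    ∩⊆S∪∩′ : V (𝓕 a) ∩ V (𝓕 b) ⊆ S ∪ (V (𝓕′ a) ∩ V (𝓕′ b))
    ∩⊆S∪∩′ {x} x∈∩ with x ∈? S | x∈p∩q⁻ (V (𝓕 a)) (V (𝓕 b)) x∈∩
    ... | yes x∈S | _ = x∈p∪q⁺ (inj₁ x∈S)
    ... | no  x∉S | x∈a , x∈b = x∈p∪q⁺ (inj₂ (x∈p∩q⁺
      (x∈p∪q∧x∉p⇒x∈q S _ (∈V-◁ x∈a) x∉S , x∈p∪q∧x∉p⇒x∈q S _ (∈V-◁ x∈b) x∉S)))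

  -- An (∣S∣ + k)-set x has at least k vertices outside S; any k of them lie in
  -- V(F′ j) whenever x ⊆ V(F j).
  ws2-◁ : ∀ {κ k} → WS2 κ k 𝓕′ → WS2 κ (∣ S ∣ + k) 𝓕
  ws2-◁ {k = k} ws2′ x ∣x∣≡ J x⊆members
    with ∃-⊆-ofSize k (x ─ S)
           (+-cancelˡ-≤ ∣ S ∣ k _ (≤-trans (≤-reflexive (sym ∣x∣≡)) (∣q∣≤∣p∣+∣q─p∣ S x)))
  ... | y , y⊆x─S , ∣y∣≡k = ws2′ y ∣y∣≡k J y⊆members′
    where
    y⊆members′ : ∀ j → j ∈ J → y ⊆ V (𝓕′ j)
    y⊆members′ j j∈J x∈y = x∈p∪q∧x∉p⇒x∈q S _
      (∈V-◁ (x⊆members j j∈J (p─q⊆p x S (y⊆x─S x∈y)))) (x∈p─q⇒x∉q x S (y⊆x─S x∈y))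

  shared-edge⊇S : ∀ {r} → WS1 r 𝓕 → (∀ j → Uniform r (𝓕 j)) →
    ∀ {a b e} → a ≢ b → E (𝓕 a) e → E (𝓕 b) e → S ⊆ e
  shared-edge⊇S ws1 unif {a} {b} {e} a≢b e∈a e∈b {x} x∈S =
    subst (x ∈_) (sym (shared-edge≡∩ 𝓕 ws1 unif a≢b e∈a e∈b))
      (x∈p∩q⁺ (S⊆V-◁ a x∈S , S⊆V-◁ b x∈S))

  edgeDisjoint-◁ : ∀ {r} → WS1 r 𝓕 → (∀ j → Uniform r (𝓕 j)) →
    EdgeDisjoint 𝓕′ → EdgeDisjoint 𝓕
  edgeDisjoint-◁ ws1 unif disjoint′ a b a≢b e (e∈a , e∈b) =
    disjoint′ a b a≢b (e ─ S) (edge-◁⁻ e∈a S⊆e , edge-◁⁻ e∈b S⊆e)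
    where
    S⊆e = shared-edge⊇S ws1 unif a≢b e∈a e∈b

proposition6p11 : ∀ {f n m : ℕ} (r i κ : ℕ) (F : Hypergraph f) → Uniform r F →
    1 ≤ i → i ≤ r ∸ 1 →
    (T : Subset f) → T ⊆ V F → ∣ T ∣ ≡ i → (∃ λ e → E (link F T) e) →
    (G : Hypergraph n) → IsComplex G →
    (S : Subset n) → S ⊆ V G → ∣ S ∣ ≡ i →
    (L : Subset n → Set) → (∀ e → L e → level (link G S) (r ∸ i) e) →
    (𝓕' : Family m n) → WellSeparated κ (r ∸ i) 𝓕' →
    IsDecomposition (r ∸ i) (link F T) (restrict (link G S) (r ∸ i) L) 𝓕' →
    (𝓕 : Family m n) → IsTriangle F S 𝓕' 𝓕 →
    (WellSeparated κ r 𝓕 × IsPacking r F G 𝓕)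
    × (∀ e → ((∃ λ j → E (𝓕 j) e) × S ⊆ e → ∃ λ e' → L e' × e ≡ S ∪ e')
           × ((∃ λ e' → L e' × e ≡ S ∪ e') → (∃ λ j → E (𝓕 j) e) × S ⊆ e))
proposition6p11 r i κ F F-unif _ i≤r∸1 _ _ _ _ G G-complex S _ ∣S∣≡i L L⊆G[S] 𝓕′ (ws1′ , ws2′)
  ((_ , edges′ , V′∈G[S] , disjoint′) , covers′) 𝓕 triangle =
  ((ws1 , ws2) , copy , edges , V∈G , edgeDisjoint-◁ ws1 unif disjoint′) , λ e → lower e , upper e
  where
  open Extension S 𝓕′ 𝓕 (proj₁ ∘ proj₂ ∘ triangle) (proj₂ ∘ proj₂ ∘ triangle)
  ∣S∣+[r∸i]≡r : ∣ S ∣ + (r ∸ i) ≡ r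
  ∣S∣+[r∸i]≡r = trans (cong (_+ (r ∸ i)) ∣S∣≡i) (m+[n∸m]≡n (≤-trans i≤r∸1 (m∸n≤m r 1)))
  ws1 : WS1 r 𝓕
  ws1 = subst (λ s → WS1 s 𝓕) ∣S∣+[r∸i]≡r (ws1-◁ ws1′)
  ws2 : WS2 κ r 𝓕
  ws2 = subst (λ s → WS2 κ s 𝓕) ∣S∣+[r∸i]≡r (ws2-◁ ws2′)
  copy : ∀ j → IsCopy F (𝓕 j)
  copy = proj₁ ∘ triangle
  unif : ∀ j → Uniform r (𝓕 j)
  unif j = copy-uniform {F = F} {𝓕 j} F-unif (copy j)
  V∈G : ∀ j → level G ∣ V F ∣ (V (𝓕 j))
  V∈G j = subst (E G) (sym (proj₁ (proj₂ (triangle j)))) (proj₂ (proj₁ (proj₁ (V′∈G[S] j))))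
        , copy-∣V∣ {F = F} {𝓕 j} (copy j)
  edges : ∀ j e → E (𝓕 j) e → level G r e
  edges j e e∈𝓕 = G-complex _ e (proj₁ (V∈G j)) (E⊆V (𝓕 j) e e∈𝓕) , unif j e e∈𝓕
  lower : ∀ e → (∃ λ j → E (𝓕 j) e) × S ⊆ e → ∃ λ e′ → L e′ × e ≡ S ∪ e′
  lower e ((j , e∈𝓕) , S⊆e) =
    e ─ S , restrict-level⁻ {G = link G S} (edges′ j (e ─ S) (edge-◁⁻ e∈𝓕 S⊆e)) , sym (p⊆q⇒p∪[q─p]≡q S⊆e)
  upper : ∀ e → (∃ λ e′ → L e′ × e ≡ S ∪ e′) → (∃ λ j → E (𝓕 j) e) × S ⊆ e
  upper _ (e′ , Le′ , refl) with covers′ e′ (restrict-level⁺ {G = link G S} Le′ (L⊆G[S] e′ Le′))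
  ... | j , e′∈𝓕′ = (j , edge-◁⁺ e′∈𝓕′) , p⊆p∪q e′
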